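{- Let $G$ be a chordal graph, let $S$ be a minimal vertex separator of $G$, let $R$ be a proper subset of $S$, and let $S' = S \setminus R$. Then there exist cliques $C_1'$ and $C_2'$ of the graph $G \setminus R$ (the graph obtained from $G$ by deleting the vertices of $R$) such that $S'$ separates $C_1'$ and $C_2'$ in $G\setminus R$, i.e. every path in $G\setminus R$ from a vertex of $C_1'\setminus S'$ to a vertex of $C_2'\setminus S'$ contains a vertex of $S'$.
   Context: Graphs are simple, finite and undirected. A graph is chordal if it has no induced cycle of length at least four. A clique is a maximal set of pairwise adjacent vertices. For two non-adjacent vertices $u,v$ in the same connected component of $G$, a $uv$-separator is a set $S\subseteq V(G)$ such that $u$ and $v$ lie in different connected components of $G\setminus S$; it is minimal if no proper subset of it is a $uv$-separator. A minimal vertex separator of $G$ is a set that is a minimal $uv$-separator for some pair of non-adjacent vertices $u,v$. -}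

module Defs where

open import Data.Nat using (ℕ; zero; suc; _≤_)
open import Data.Bool using (Bool; true; false)
open import Data.Fin using (Fin; toℕ)
open import Data.Fin.Subset using (Subset; ⊤; _∈_; _∉_; _⊆_; _⊂_; ∁; _─_)
open import Data.List using (List; []; _∷_)
open import Data.List.Relation.Unary.Any using (Any)
open import Data.List.Relation.Unary.Unique.Propositional using (Unique)
open import Data.Product using (Σ; ∃; _×_; _,_)
open import Data.Sum using (_⊎_)
open import Relation.Nullary using (¬_)
open import Relation.Binary.PropositionalEquality using (_≡_; _≢_)
open import Function.Definitions using (Injective)

record Graph (n : ℕ) : Set where
  field
    adj    : Fin n → Fin n → Bool
    sym    : ∀ u v → adj u v ≡ adj v u
    irrefl : ∀ v → adj v v ≡ false

open Graph public

Adj : ∀ {n} → Graph n → Fin n → Fin n → Set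
Adj G u v = adj G u v ≡ true

-- Walks and paths in the induced subgraph G[W] (all vertices lie in W).
-- G \ R is G[∁ R]; G itself is G[⊤].

data Walk {n} (G : Graph n) (W : Subset n) : Fin n → Fin n → Set where
  single : ∀ {v} → v ∈ W → Walk G W v v
  cons   : ∀ {u v w} → u ∈ W → Adj G u v → Walk G W v w → Walk G W u w

verts : ∀ {n} {G : Graph n} {W : Subset n} {u v} → Walk G W u v → List (Fin n)
verts (single {v} _) = v ∷ []
verts (cons {u} _ _ p) = u ∷ verts p

IsPath : ∀ {n} {G : Graph n} {W : Subset n} {u v} → Walk G W u v → Set
IsPath p = Unique (verts p)

Connected : ∀ {n} → Graph n → Subset n → Fin n → Fin n → Set
Connected G W u v = ∃ λ (p : Walk G W u v) → IsPath p

Consec : ∀ {k} → Fin k → Fin k → Set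
Consec {k} i j = (suc (toℕ i) ≡ toℕ j) ⊎ (suc (toℕ i) ≡ k × toℕ j ≡ 0)

CycAdj : ∀ {k} → Fin k → Fin k → Set
CycAdj i j = Consec i j ⊎ Consec j i

IsInducedCycle : ∀ {n k} → Graph n → (Fin k → Fin n) → Set
IsInducedCycle G c =
  Injective _≡_ _≡_ c × (∀ i j → (Adj G (c i) (c j) → CycAdj i j) × (CycAdj i j → Adj G (c i) (c j)))

Chordal : ∀ {n} → Graph n → Set
Chordal {n} G = ∀ k → 4 ≤ k → (c : Fin k → Fin n) → ¬ IsInducedCycle G c

everything : ∀ {n} → Subset n
everything = ⊤

IsSeparator : ∀ {n} → Graph n → Fin n → Fin n → Subset n → Set
IsSeparator G u v S = u ∉ S × v ∉ S × ¬ Connected G (∁ S) u v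

IsMinimalSeparator : ∀ {n} → Graph n → Fin n → Fin n → Subset n → Set
IsMinimalSeparator G u v S =
  IsSeparator G u v S × (∀ T → T ⊂ S → ¬ IsSeparator G u v T)

IsMinimalVertexSeparator : ∀ {n} → Graph n → Subset n → Set
IsMinimalVertexSeparator G S =
  ∃ λ u → ∃ λ v → u ≢ v × ¬ Adj G u v × Connected G everything u v
    × IsMinimalSeparator G u v S

Complete : ∀ {n} → Graph n → Subset n → Set
Complete G C = ∀ {x y} → x ∈ C → y ∈ C → x ≢ y → Adj G x y

IsClique : ∀ {n} → Graph n → Subset n → Subset n → Set
IsClique G W C =
  C ⊆ W × Complete G C × (∀ D → C ⊆ D → D ⊆ W → Complete G D → D ⊆ C)

Separates : ∀ {n} → Graph n → Subset n → Subset n → Subset n → Subset n → Set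
Separates G W S C₁ C₂ =
  ∀ x y → x ∈ C₁ → x ∉ S → y ∈ C₂ → y ∉ S →
    (p : Walk G W x y) → IsPath p → Any (_∈ S) (verts p)

module Submission where

-- Let S be a minimal u v-separator and R ⊂ S.  Since u, v ∉ S,
-- both lie in G ∖ R, so each lies in some clique of G ∖ R: take C₁ ∋ u and
-- C₂ ∋ v.  These cliques are separated by S' = S ∖ R: a path in G ∖ R from
-- x ∈ C₁ ∖ S' to y ∈ C₂ ∖ S' avoiding S' avoids all of S, and prefixing the
-- edge u x (inside the complete set C₁) and appending the edge y v gives a
-- u v-walk in G ∖ S, hence a u v-path — contradicting that S separates u, v.

open import Defs
open import Data.Nat using (ℕ)
open import Data.Fin using (Fin)
open import Data.Fin.Properties using (_≟_; any?; all?)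
open import Data.Fin.Subset
  using (Subset; _⊂_; _⊃_; ∁; _─_; _∈_; _∉_; _⊆_; _∪_; ⁅_⁆)
open import Data.Fin.Subset.Properties
  using (_∈?_; x∈p∪q⁻; x∈p∪q⁺; p⊆p∪q; x∈⁅x⁆; x∈⁅y⁆⇒x≡y;
         x∉p⇒x∈∁p; x∈∁p⇒x∉p; x∈p∧x∉q⇒x∈p─q)
open import Data.Fin.Subset.Induction using (⊃-wellFounded)
open import Induction.WellFounded using (Acc; acc)
open import Data.Bool using (true)
import Data.Bool as Bool
open import Data.List using (_∷_; [])
open import Data.List.Relation.Unary.Any using (Any; here; there)
import Data.List.Relation.Unary.Any as Any
open import Data.List.Relation.Unary.All using (All)
open import Data.List.Relation.Unary.All.Properties.Core using (¬Any⇒All¬)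
open import Data.List.Relation.Unary.AllPairs using (_∷_; [])
open import Data.Product using (∃; ∃₂; Σ; _×_; _,_; proj₁; proj₂)
open import Data.Sum using (_⊎_; inj₁; inj₂)
open import Function using (_∘_)
open import Relation.Nullary using (¬_; Dec; yes; no; contradiction)
open import Relation.Nullary.Decidable using (_×-dec_; _→-dec_; ¬?)
open import Relation.Binary.PropositionalEquality
  using (_≡_; _≢_; refl; trans) renaming (sym to ≡-sym)

module Walks {n : ℕ} (G : Graph n) where

  _++ᵂ_ : ∀ {W a b c} → Walk G W a b → Walk G W b c → Walk G W a c
  single _ ++ᵂ q = q
  cons a∈W e p ++ᵂ q = cons a∈W e (p ++ᵂ q)

  complete-walk : ∀ {W C a b} → Complete G C → a ∈ C → b ∈ C →
                  a ∈ W → b ∈ W → Walk G W a b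
  complete-walk {a = a} {b} cC a∈C b∈C a∈W b∈W with a ≟ b
  ... | yes refl = single b∈W
  ... | no a≢b   = cons a∈W (cC a∈C b∈C a≢b) (single b∈W)

  path-suffix : ∀ {W a b c} (q : Walk G W b c) → Any (a ≡_) (verts q) →
                IsPath q → Σ (Walk G W a c) IsPath
  path-suffix (single b∈W)     (here refl) uq       = single b∈W , uq
  path-suffix (cons b∈W e q)   (here refl) uq       = cons b∈W e q , uq
  path-suffix (cons _ _ q)     (there a∈q) (_ ∷ uq) = path-suffix q a∈q uq

  -- Every walk can be shortened to a path with the same end points
  -- (cut out the closed detour whenever the first vertex reappears).
  walk⇒path : ∀ {W a b} → Walk G W a b → Connected G W a b
  walk⇒path (single b∈W) = single b∈W , (All.[] ∷ [])
  walk⇒path {a = a} (cons a∈W e p) with walk⇒path p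
  ... | q , uq with Any.any? (a ≟_) (verts q)
  ...   | yes a∈q = path-suffix q a∈q uq
  ...   | no  a∉q = cons a∈W e q , (¬Any⇒All¬ (verts q) a∉q ∷ uq)

  relocate : ∀ {W W' T : Subset n} {a b} →
             (∀ {z} → z ∈ W → z ∉ T → z ∈ W') →
             (p : Walk G W a b) → ¬ Any (_∈ T) (verts p) → Walk G W' a b
  relocate move (single z∈W) avoid = single (move z∈W (avoid ∘ here))
  relocate move (cons z∈W e p) avoid =
    cons (move z∈W (avoid ∘ here)) e (relocate move p (avoid ∘ there))

module Cliques {n : ℕ} (G : Graph n) where

  adj-sym : ∀ {x y} → Adj G x y → Adj G y x
  adj-sym {x} {y} e = trans (Graph.sym G y x) e

  Extends : Subset n → Subset n → Fin n → Set
  Extends W C w = w ∈ W × w ∉ C × (∀ x → x ∈ C → x ≢ w → Adj G x w)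

  extends? : ∀ W C w → Dec (Extends W C w)
  extends? W C w = (w ∈? W) ×-dec ¬? (w ∈? C) ×-dec
    all? (λ x → (x ∈? C) →-dec (¬? (x ≟ w) →-dec (adj G x w Bool.≟ true)))

  unextendable⇒clique : ∀ {W C} → C ⊆ W → Complete G C →
                        ¬ ∃ (Extends W C) → IsClique G W C
  unextendable⇒clique {W} {C} C⊆W cC none = C⊆W , cC , maximal
    where
    maximal : ∀ D → C ⊆ D → D ⊆ W → Complete G D → D ⊆ C
    maximal D C⊆D D⊆W cD {y} y∈D with y ∈? C
    ... | yes y∈C = y∈C
    ... | no  y∉C = contradiction
      (y , D⊆W y∈D , y∉C , λ x x∈C x≢y → cD (C⊆D x∈C) y∈D x≢y) none

  module Grow {W C : Subset n} {w : Fin n} (ext : Extends W C w) where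

    ∈-grown⁻ : ∀ {x} → x ∈ C ∪ ⁅ w ⁆ → x ∈ C ⊎ x ≡ w
    ∈-grown⁻ x∈ with x∈p∪q⁻ C ⁅ w ⁆ x∈
    ... | inj₁ x∈C = inj₁ x∈C
    ... | inj₂ x∈w = inj₂ (x∈⁅y⁆⇒x≡y w x∈w)

    grows : C ⊂ C ∪ ⁅ w ⁆
    grows = p⊆p∪q ⁅ w ⁆ , w , x∈p∪q⁺ (inj₂ (x∈⁅x⁆ w)) , proj₁ (proj₂ ext)

    grown⊆W : C ⊆ W → C ∪ ⁅ w ⁆ ⊆ W
    grown⊆W C⊆W x∈ with ∈-grown⁻ x∈
    ... | inj₁ x∈C  = C⊆W x∈C
    ... | inj₂ refl = proj₁ ext

    grown-complete : Complete G C → Complete G (C ∪ ⁅ w ⁆)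
    grown-complete cC x∈ y∈ x≢y with ∈-grown⁻ x∈ | ∈-grown⁻ y∈
    ... | inj₁ x∈C  | inj₁ y∈C  = cC x∈C y∈C x≢y
    ... | inj₁ x∈C  | inj₂ refl = proj₂ (proj₂ ext) _ x∈C x≢y
    ... | inj₂ refl | inj₁ y∈C  = adj-sym (proj₂ (proj₂ ext) _ y∈C (x≢y ∘ ≡-sym))
    ... | inj₂ refl | inj₂ refl = contradiction refl x≢y

  -- Every complete subset of W extends to a clique of G[W]: grow greedily;
  -- this terminates because the sets strictly increase.
  extend-to-clique : ∀ {W} C → Acc _⊃_ C → C ⊆ W → Complete G C →
                     ∃ λ D → C ⊆ D × IsClique G W D
  extend-to-clique {W} C (acc larger) C⊆W cC with any? (extends? W C)
  ... | no  none = C , (λ x∈C → x∈C) , unextendable⇒clique C⊆W cC none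
  ... | yes (w , ext) with extend-to-clique (C ∪ ⁅ w ⁆) (larger grows)
                             (grown⊆W C⊆W) (grown-complete cC)
    where open Grow ext
  ...   | D , grown⊆D , clique = D , grown⊆D ∘ p⊆p∪q ⁅ w ⁆ , clique

  clique-containing : ∀ {W} u → u ∈ W → ∃ λ D → u ∈ D × IsClique G W D
  clique-containing {W} u u∈W
    with extend-to-clique ⁅ u ⁆ (⊃-wellFounded ⁅ u ⁆) singleton⊆W singleton-complete
    where
    singleton⊆W : ⁅ u ⁆ ⊆ W
    singleton⊆W x∈ with x∈⁅y⁆⇒x≡y u x∈
    ... | refl = u∈W
    singleton-complete : Complete G ⁅ u ⁆
    singleton-complete x∈ y∈ x≢y =
      contradiction (trans (x∈⁅y⁆⇒x≡y u x∈) (≡-sym (x∈⁅y⁆⇒x≡y u y∈))) x≢y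
  ... | D , u⊆D , clique = D , u⊆D (x∈⁅x⁆ u) , clique

separated-through-separator :
  ∀ {n} (G : Graph n) {S R C₁ C₂ : Subset n} {u v} →
  IsSeparator G u v S → R ⊆ S →
  u ∈ C₁ → C₁ ⊆ ∁ R → Complete G C₁ →
  v ∈ C₂ → C₂ ⊆ ∁ R → Complete G C₂ →
  Separates G (∁ R) (S ─ R) C₁ C₂
separated-through-separator G {S} {R} (u∉S , v∉S , disconnected) R⊆S
    u∈C₁ C₁⊆∁R cC₁ v∈C₂ C₂⊆∁R cC₂ x y x∈C₁ x∉S' y∈C₂ y∉S' p _
  with Any.any? (_∈? (S ─ R)) (verts p)
... | yes hits  = hits
... | no  avoid = contradiction (walk⇒path u⋯v) disconnected
  where
  open Walks G

  outside-S : ∀ {z} → z ∈ ∁ R → z ∉ S ─ R → z ∈ ∁ S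
  outside-S z∈∁R z∉S' = x∉p⇒x∈∁p (λ z∈S → z∉S' (x∈p∧x∉q⇒x∈p─q z∈S (x∈∁p⇒x∉p z∈∁R)))

  u∈∁S : _ ∈ ∁ S
  u∈∁S = x∉p⇒x∈∁p u∉S
  v∈∁S : _ ∈ ∁ S
  v∈∁S = x∉p⇒x∈∁p v∉S

  u⋯v : Walk G (∁ S) _ _
  u⋯v = complete-walk cC₁ u∈C₁ x∈C₁ u∈∁S (outside-S (C₁⊆∁R x∈C₁) x∉S')
     ++ᵂ (relocate outside-S p avoid
     ++ᵂ complete-walk cC₂ y∈C₂ v∈C₂ (outside-S (C₂⊆∁R y∈C₂) y∉S') v∈∁S)

lemma2p1 : ∀ {n} (G : Graph n) (S R : Subset n) →
    Chordal G → IsMinimalVertexSeparator G S → R ⊂ S →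
    ∃₂ λ C₁ C₂ → IsClique G (∁ R) C₁ × IsClique G (∁ R) C₂ ×
      Separates G (∁ R) (S ─ R) C₁ C₂
lemma2p1 G S R _ (u , v , _ , _ , _ , separator , _) (R⊆S , _)
  with clique-containing u (outside-R (proj₁ separator))
     | clique-containing v (outside-R (proj₁ (proj₂ separator)))
  where
  open Cliques G
  outside-R : ∀ {z} → z ∉ S → z ∈ ∁ R
  outside-R z∉S = x∉p⇒x∈∁p (z∉S ∘ R⊆S)
... | C₁ , u∈C₁ , clique₁@(C₁⊆∁R , cC₁ , _) | C₂ , v∈C₂ , clique₂@(C₂⊆∁R , cC₂ , _) =
  C₁ , C₂ , clique₁ , clique₂ ,
  separated-through-separator G separator R⊆S u∈C₁ C₁⊆∁R cC₁ v∈C₂ C₂⊆∁R cC₂
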